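{- For every positive integer $k$, $b_2(K_{2k+1})=k+1$.
   Context: $K_n$ is the complete graph on $n$ vertices. An odd cover of a graph $G$ is a collection of complete bipartite graphs with disjoint parts $(X,Y)$, $X,Y\subseteq V(G)$, such that each edge of $G$ is covered (one endpoint in $X$, the other in $Y$) by an odd number of them and each nonedge by an even number; $b_2(G)$ is the minimum cardinality of an odd cover of $G$. -}

module Defs where

open import Data.Nat using (ℕ; zero; suc; _+_; _*_; _≤_)
open import Data.Nat.Properties using ()
open import Data.Bool using (Bool; true; false; _∧_; _∨_; not; _xor_)
open import Data.Fin using (Fin)
open import Data.Fin.Properties using (_≟_)
open import Data.List using (List; length; foldr)
open import Data.Product using (_×_; Σ; _,_; ∃-syntax)
open import Relation.Nullary using (¬_)
open import Relation.Nullary.Decidable using (⌊_⌋)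
open import Relation.Binary.PropositionalEquality using (_≡_; _≢_)

record Graph (n : ℕ) : Set where
  field
    adj   : Fin n → Fin n → Bool
    adj-sym : ∀ u v → adj u v ≡ adj v u
    adj-irrefl : ∀ u → adj u u ≡ false
open Graph public

K : (n : ℕ) → Graph n
K n = record
  { adj = λ u v → not ⌊ u ≟ v ⌋
  ; adj-sym = λ u v → symm u v
  ; adj-irrefl = λ u → irr u }
  where
  open import Relation.Binary.PropositionalEquality using (refl; sym)
  open import Relation.Nullary using (yes; no)
  symm : ∀ (u v : Fin n) → not ⌊ u ≟ v ⌋ ≡ not ⌊ v ≟ u ⌋
  symm u v with u ≟ v | v ≟ u
  ... | yes _ | yes _ = refl
  ... | no _  | no _  = refl
  ... | yes p | no q  = Data.Empty.⊥-elim (q (sym p))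
    where import Data.Empty
  ... | no p  | yes q = Data.Empty.⊥-elim (p (sym q))
    where import Data.Empty
  irr : ∀ (u : Fin n) → not ⌊ u ≟ u ⌋ ≡ false
  irr u with u ≟ u
  ... | yes _ = refl
  ... | no p  = Data.Empty.⊥-elim (p refl)
    where import Data.Empty

record Biclique (n : ℕ) : Set where
  field
    X : Fin n → Bool
    Y : Fin n → Bool
    disjoint : ∀ v → X v ∧ Y v ≡ false
open Biclique public

covers : ∀ {n} → Biclique n → Fin n → Fin n → Bool
covers B u v = (X B u ∧ Y B v) ∨ (X B v ∧ Y B u)

coverParity : ∀ {n} → List (Biclique n) → Fin n → Fin n → Bool
coverParity Bs u v = foldr (λ B acc → covers B u v xor acc) false Bs

IsOddCover : ∀ {n} → Graph n → List (Biclique n) → Set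
IsOddCover {n} G Bs = ∀ (u v : Fin n) → u ≢ v → coverParity Bs u v ≡ adj G u v

b₂≡ : ∀ {n} → Graph n → ℕ → Set
b₂≡ {n} G m =
  (∃[ Bs ] (IsOddCover G Bs × length Bs ≡ m)) ×
  (∀ (Bs : List (Biclique n)) → IsOddCover G Bs → m ≤ length Bs)

-- Over 𝔽₂, an odd cover {(Xᵢ , Yᵢ)} of Kₙ is a decomposition J + I = Σᵢ (xᵢ yᵢᵀ + yᵢ xᵢᵀ) of its
-- adjacency matrix, xᵢ and yᵢ being the indicator vectors of Xᵢ and Yᵢ.
--
-- Lower bound: let n = 2k + 3 and suppose there are at most k + 1 bicliques. On the last n − 1
-- vertices, the at most 2k + 1 vectors x₁ and xᵢ, yᵢ (i ≥ 2) have a common nonzero orthogonal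
-- vector; extend it by 0 on the first vertex to get u. Applying both sides to u gives
-- (Σ u) 𝟙 + u = (y₁ · u) x₁. The left side is not constant, so y₁ · u = 1 and x₁ = (Σ u) 𝟙 + u;
-- as X₁ and Y₁ are disjoint this forces |Y₁| odd and, n being odd, |X₁| even. Exchanging the
-- roles of X₁ and Y₁ gives |Y₁| even as well, a contradiction.
--
-- Upper bound: by induction, K₂ₘ₊₁ has an odd cover by m + 1 bicliques in which Σᵢ xᵢ = y₁. Given
-- two new vertices a and b, put a into X₁ and b into Y₁ and into every other Yᵢ, and add the
-- biclique ({a , b} , V ∖ Y₁); the invariant makes every pair {b , v} covered an odd number of
-- times.

module Submission where

open import Defs
open import Algebra.Bundles using (CommutativeRing)
open import Data.Bool using (Bool; true; false; _∧_; _∨_; not; _xor_)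
open import Data.Bool.Properties
  using ( xor-∧-commutativeRing; xor-assoc; xor-same; xor-comm; xor-identityʳ
        ; xor-inverseˡ; xor-inverseʳ; ∧-distribˡ-xor; ∧-distribʳ-xor; ∧-assoc; ∧-comm
        ; ∧-identityʳ; ∧-zeroʳ; ∧-conicalˡ; ∧-conicalʳ; ∨-comm; ∨-identityʳ
        ; not-involutive; ¬-not )
  renaming (_≟_ to _≟ᵇ_)
open import Data.Empty using (⊥)
open import Data.Fin using (Fin; zero; suc)
open import Data.Fin.Properties using (_≟_)
open import Data.List using (List; []; _∷_; length; map; foldr)
open import Data.List.Properties using (length-map; length-removeAt′)
open import Data.List.Relation.Unary.All as All using (All; []; _∷_)
open import Data.List.Relation.Unary.All.Properties using (map⁻; ─⁻; ¬Any⇒All¬)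
open import Data.List.Relation.Unary.Any as Any using (any?; _─_)
open import Data.List.Relation.Unary.Any.Properties using (lookup-result)
open import Data.Nat using (ℕ; zero; suc; _*_; _≤_; _<_; s≤s⁻¹)
open import Data.Nat.Properties using (≮⇒≥; *-suc; *-monoʳ-≤)
open import Data.Product using (_×_; _,_; proj₁; proj₂; ∃-syntax)
open import Data.Vec.Functional as V using (Vector; tail)
open import Relation.Nullary using (yes; no; contradiction)
open import Relation.Nullary.Decidable using (⌊_⌋; ⌊⌋-map′)
open import Relation.Binary.PropositionalEquality
open import Algebra.Properties.Semiring.Sum (CommutativeRing.semiring xor-∧-commutativeRing)
  using (sum; sum-cong-≗; sum-replicate-zero; ∑-distrib-+; *-distribˡ-sum; *-distribʳ-sum)
open import Algebra.Properties.CommutativeSemigroup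
  (CommutativeRing.+-commutativeSemigroup xor-∧-commutativeRing) using (x∙yz≈y∙xz)

open ≡-Reasoning

private
  variable
    n : ℕ

xor-moveˡ : ∀ {x} p u → x ≡ p xor u → u ≡ p xor x
xor-moveˡ p u refl = begin
  u                 ≡⟨⟩
  false xor u       ≡⟨ cong (_xor u) (xor-same p) ⟨
  (p xor p) xor u   ≡⟨ xor-assoc p p u ⟩
  p xor (p xor u)   ∎

∨-as-xor : ∀ a b x y → a ∧ b ≡ false → a ∧ y ∨ x ∧ b ≡ a ∧ y xor b ∧ x
∨-as-xor false false x y _ = ∧-zeroʳ x
∨-as-xor false true  x y _ = ∧-identityʳ x
∨-as-xor true  false x y _ =
  trans (cong (y ∨_) (∧-zeroʳ x)) (trans (∨-identityʳ y) (sym (xor-identityʳ y)))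

separating-scalar : ∀ x y c p → x ∧ c ≡ p xor false → y ∧ c ≡ p xor true → c ≡ true
separating-scalar x y true  p     _  _  = refl
separating-scalar x y false false _  eʸ = contradiction (trans (sym (∧-zeroʳ y)) eʸ) λ ()
separating-scalar x y false true  eˣ _  = contradiction (trans (sym (∧-zeroʳ x)) eˣ) λ ()

-- Linear algebra over 𝔽₂

infix 7 _·_
_·_ : Vector Bool n → Vector Bool n → Bool
u · v = sum (λ i → u i ∧ v i)

·-congˡ : {u u′ : Vector Bool n} → (∀ i → u i ≡ u′ i) → ∀ w → u · w ≡ u′ · w
·-congˡ eq w = sum-cong-≗ (λ i → cong (_∧ w i) (eq i))

·-xorˡ : ∀ (u v w : Vector Bool n) → (λ i → u i xor v i) · w ≡ u · w xor v · w
·-xorˡ u v w = trans (sum-cong-≗ (λ i → ∧-distribʳ-xor (w i) (u i) (v i)))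
  (∑-distrib-+ (λ i → u i ∧ w i) (λ i → v i ∧ w i))

·-xorʳ : ∀ (u v w : Vector Bool n) → u · (λ i → v i xor w i) ≡ u · v xor u · w
·-xorʳ u v w = trans (sum-cong-≗ (λ i → ∧-distribˡ-xor (u i) (v i) (w i)))
  (∑-distrib-+ (λ i → u i ∧ v i) (λ i → u i ∧ w i))

·-∧ˡ : ∀ c (u w : Vector Bool n) → (λ i → c ∧ u i) · w ≡ c ∧ u · w
·-∧ˡ c u w = trans (sum-cong-≗ (λ i → ∧-assoc c (u i) (w i)))
  (sym (*-distribˡ-sum c (λ i → u i ∧ w i)))

·-constʳ : ∀ (u : Vector Bool n) c → u · (λ _ → c) ≡ sum u ∧ c
·-constʳ u c = sym (*-distribʳ-sum c u)

·-false∷ : ∀ (r : Vector Bool (suc n)) u → r · (false V.∷ u) ≡ tail r · u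
·-false∷ r u = cong (_xor tail r · u) (∧-zeroʳ (r zero))

⌊suc≟suc⌋ : ∀ (u v : Fin n) → ⌊ suc u ≟ suc v ⌋ ≡ ⌊ u ≟ v ⌋
⌊suc≟suc⌋ u v = ⌊⌋-map′ _ _ (u ≟ v)

indicator-· : ∀ (v : Fin n) S → (λ s → ⌊ v ≟ s ⌋) · S ≡ S v
indicator-· {suc n} zero    S =
  trans (cong (S zero xor_) (sum-replicate-zero n)) (xor-identityʳ (S zero))
indicator-· {suc n} (suc v) S =
  trans (sum-cong-≗ (λ s → cong (_∧ S (suc s)) (⌊suc≟suc⌋ v s))) (indicator-· v (tail S))

sum-true-odd : ∀ m → sum {suc (2 * m)} (λ _ → true) ≡ true
sum-true-odd zero    = refl
sum-true-odd (suc m) = subst (λ l → sum {suc l} (λ _ → true) ≡ true) (sym (*-suc 2 m))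
  (trans (not-involutive _) (sum-true-odd m))

eliminate : Vector Bool (suc n) → Vector Bool (suc n) → Vector Bool n
eliminate p r i = r (suc i) xor r zero ∧ p (suc i)

backSubstitute : Vector Bool (suc n) → Vector Bool n → Vector Bool (suc n)
backSubstitute p S = (tail p · S) V.∷ S

pivot-·-backSubstitute : ∀ (p : Vector Bool (suc n)) → p zero ≡ true →
  ∀ S → p · backSubstitute p S ≡ false
pivot-·-backSubstitute p p₀ S =
  trans (cong (λ b → b ∧ tail p · S xor tail p · S) p₀) (xor-same (tail p · S))

·-backSubstitute : ∀ (p r : Vector Bool (suc n)) S → r · backSubstitute p S ≡ eliminate p r · S
·-backSubstitute p r S = begin
  r zero ∧ tail p · S xor tail r · S              ≡⟨ xor-comm (r zero ∧ tail p · S) (tail r · S) ⟩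
  tail r · S xor r zero ∧ tail p · S              ≡⟨ cong (tail r · S xor_) (·-∧ˡ (r zero) (tail p) S) ⟨
  tail r · S xor (λ i → r zero ∧ p (suc i)) · S  ≡⟨ ·-xorˡ (tail r) _ S ⟨
  eliminate p r · S                              ∎

nonzero-solution : ∀ a (rows : List (Vector Bool a)) → length rows < a →
  ∃[ S ] (∃[ i ] S i ≡ true) × All (λ r → r · S ≡ false) rows
nonzero-solution zero    rows ()
nonzero-solution (suc a) rows fewer with any? (λ r → r zero ≟ᵇ true) rows
... | no noPivot = e₀ , (zero , refl) , All.map (λ {r} → e₀-orth r) (¬Any⇒All¬ rows noPivot)
  where
  e₀ : Vector Bool (suc a)
  e₀ = true V.∷ λ _ → false
  e₀-orth : ∀ r → r zero ≢ true → r · e₀ ≡ false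
  e₀-orth r r₀ = begin
    r zero ∧ true xor tail r · (λ _ → false)
      ≡⟨ cong₂ _xor_ (∧-identityʳ (r zero)) (·-constʳ (tail r) false) ⟩
    r zero xor sum (tail r) ∧ false
      ≡⟨ cong₂ _xor_ (¬-not r₀) (∧-zeroʳ _) ⟩
    false
      ∎
... | yes pivot =
  let S , (i , Sᵢ) , orth = nonzero-solution a (map (eliminate p) (rows ─ pivot)) fewer′
  in  backSubstitute p S , (suc i , Sᵢ)
    , ─⁻ pivot (pivot-·-backSubstitute p (lookup-result pivot) S)
               (All.map (λ {r} → trans (·-backSubstitute p r S)) (map⁻ orth))
  where
  p : Vector Bool (suc a)
  p = Any.lookup pivot
  fewer′ : length (map (eliminate p) (rows ─ pivot)) < a
  fewer′ = subst (_< a) (sym (length-map (eliminate p) (rows ─ pivot)))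
    (s≤s⁻¹ (subst (_< suc a) (length-removeAt′ rows (Any.index pivot)) fewer))

-- Odd covers

-- IsOddCover, but also on the diagonal: the 𝔽₂-adjacency matrix of G is the sum of those of Bs.
Represents : Graph n → List (Biclique n) → Set
Represents {n} G Bs = ∀ (u v : Fin n) → coverParity Bs u v ≡ adj G u v

coverParity-diag : ∀ (Bs : List (Biclique n)) u → coverParity Bs u u ≡ false
coverParity-diag []       u = refl
coverParity-diag (B ∷ Bs) u rewrite disjoint B u = coverParity-diag Bs u

coverParity-sym : ∀ (Bs : List (Biclique n)) u v → coverParity Bs u v ≡ coverParity Bs v u
coverParity-sym []       u v = refl
coverParity-sym (B ∷ Bs) u v =
  cong₂ _xor_ (∨-comm (X B u ∧ Y B v) (X B v ∧ Y B u)) (coverParity-sym Bs u v)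

isOddCover⇒represents : ∀ {G : Graph n} {Bs} → IsOddCover G Bs → Represents G Bs
isOddCover⇒represents {G = G} {Bs} cover u v with u ≟ v
... | yes refl = trans (coverParity-diag Bs u) (sym (adj-irrefl G u))
... | no  u≢v  = cover u v u≢v

swap : Biclique n → Biclique n
swap B = record
  { X = Y B ; Y = X B ; disjoint = λ v → trans (∧-comm (Y B v) (X B v)) (disjoint B v) }

represents-swap : ∀ {G : Graph n} {Bs} → Represents G Bs → Represents G (map swap Bs)
represents-swap {Bs = Bs} rep u v = trans (swap-parity Bs) (rep u v)
  where
  swap-parity : ∀ Bs → coverParity (map swap Bs) u v ≡ coverParity Bs u v
  swap-parity []       = refl
  swap-parity (B ∷ Bs) = cong₂ _xor_
    (trans (cong₂ _∨_ (∧-comm (Y B u) (X B v)) (∧-comm (Y B v) (X B u)))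
           (∨-comm (X B v ∧ Y B u) (X B u ∧ Y B v)))
    (swap-parity Bs)

sides : List (Biclique n) → List (Vector Bool n)
sides []       = []
sides (B ∷ Bs) = X B ∷ Y B ∷ sides Bs

length-sides : ∀ (Bs : List (Biclique n)) → length (sides Bs) ≡ 2 * length Bs
length-sides []       = refl
length-sides (B ∷ Bs) =
  trans (cong (λ l → suc (suc l)) (length-sides Bs)) (sym (*-suc 2 (length Bs)))

-- The lower bound

covers-· : ∀ (B : Biclique n) v S → covers B v · S ≡ X B v ∧ Y B · S xor Y B v ∧ X B · S
covers-· B v S = begin
  covers B v · S
    ≡⟨ ·-congˡ covers-as-xor S ⟩
  (λ s → X B v ∧ Y B s xor Y B v ∧ X B s) · S
    ≡⟨ ·-xorˡ _ _ S ⟩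
  (λ s → X B v ∧ Y B s) · S xor (λ s → Y B v ∧ X B s) · S
    ≡⟨ cong₂ _xor_ (·-∧ˡ (X B v) (Y B) S) (·-∧ˡ (Y B v) (X B) S) ⟩
  X B v ∧ Y B · S xor Y B v ∧ X B · S
    ∎
  where
  covers-as-xor : ∀ s → covers B v s ≡ X B v ∧ Y B s xor Y B v ∧ X B s
  covers-as-xor s = ∨-as-xor (X B v) (Y B v) (X B s) (Y B s) (disjoint B v)

sides-orthogonal : ∀ (B : Biclique n) → Y B · X B ≡ false
sides-orthogonal {n} B =
  trans (sum-cong-≗ (λ v → trans (∧-comm (Y B v) (X B v)) (disjoint B v))) (sum-replicate-zero n)

coverParity-·-⊥ : ∀ (Bs : List (Biclique n)) {S} v →
  All (λ r → r · S ≡ false) (sides Bs) → coverParity Bs v · S ≡ false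
coverParity-·-⊥ {n} []       v _ = sum-replicate-zero n
coverParity-·-⊥ (B ∷ Bs) {S} v (X·S ∷ Y·S ∷ rest) = begin
  coverParity (B ∷ Bs) v · S
    ≡⟨ ·-xorˡ (covers B v) (coverParity Bs v) S ⟩
  covers B v · S xor coverParity Bs v · S
    ≡⟨ cong₂ _xor_ (covers-· B v S) (coverParity-·-⊥ Bs v rest) ⟩
  (X B v ∧ Y B · S xor Y B v ∧ X B · S) xor false
    ≡⟨ cong₂ (λ a b → (X B v ∧ a xor Y B v ∧ b) xor false) Y·S X·S ⟩
  (X B v ∧ false xor Y B v ∧ false) xor false
    ≡⟨ cong₂ (λ a b → (a xor b) xor false) (∧-zeroʳ (X B v)) (∧-zeroʳ (Y B v)) ⟩
  false
    ∎

represents-K-· : ∀ {Bs : List (Biclique n)} → Represents (K n) Bs →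
  ∀ S v → coverParity Bs v · S ≡ sum S xor S v
represents-K-· {Bs = Bs} rep S v = begin
  coverParity Bs v · S             ≡⟨ ·-congˡ (rep v) S ⟩
  (λ s → true xor ⌊ v ≟ s ⌋) · S  ≡⟨ ·-xorˡ (λ _ → true) (λ s → ⌊ v ≟ s ⌋) S ⟩
  sum S xor (λ s → ⌊ v ≟ s ⌋) · S ≡⟨ cong (sum S xor_) (indicator-· v S) ⟩
  sum S xor S v                    ∎

kernel-vector-parities : ∀ {B : Biclique n} {Bs} → Represents (K n) (B ∷ Bs) →
  sum {n} (λ _ → true) ≡ true →
  ∀ {U z i} → U z ≡ false → U i ≡ true → All (λ r → r · U ≡ false) (X B ∷ sides Bs) →
  sum (X B) ≡ false × sum (Y B) ≡ true
kernel-vector-parities {n} {B} {Bs} rep odd {U} {z} {i} U₀ U₁ (X·U ∷ sides·U) =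
  X-even , ∧-conicalˡ (sum (Y B)) p Y∧p
  where
  p c : Bool
  p = sum U
  c = Y B · U

  X-scaled : ∀ v → X B v ∧ c ≡ p xor U v
  X-scaled v = begin
    X B v ∧ c                                ≡⟨ xor-identityʳ _ ⟨
    X B v ∧ c xor false                      ≡⟨ cong (X B v ∧ c xor_) (∧-zeroʳ (Y B v)) ⟨
    X B v ∧ c xor Y B v ∧ false              ≡⟨ cong (λ d → X B v ∧ c xor Y B v ∧ d) X·U ⟨
    X B v ∧ c xor Y B v ∧ X B · U            ≡⟨ covers-· B v U ⟨
    covers B v · U                           ≡⟨ xor-identityʳ _ ⟨
    covers B v · U xor false                 ≡⟨ cong (covers B v · U xor_) (coverParity-·-⊥ Bs v sides·U) ⟨
    covers B v · U xor coverParity Bs v · U  ≡⟨ ·-xorˡ (covers B v) (coverParity Bs v) U ⟨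
    coverParity (B ∷ Bs) v · U               ≡⟨ represents-K-· {Bs = B ∷ Bs} rep U v ⟩
    p xor U v                                ∎

  c≡true : c ≡ true
  c≡true = separating-scalar (X B z) (X B i) c p
    (trans (X-scaled z) (cong (p xor_) U₀)) (trans (X-scaled i) (cong (p xor_) U₁))

  X≡p+U : ∀ v → X B v ≡ p xor U v
  X≡p+U v = trans (sym (trans (cong (X B v ∧_) c≡true) (∧-identityʳ (X B v)))) (X-scaled v)

  Y∧p : sum (Y B) ∧ p ≡ true
  Y∧p = begin
    sum (Y B) ∧ p                  ≡⟨ xor-identityʳ _ ⟨
    sum (Y B) ∧ p xor false        ≡⟨ cong₂ _xor_ (·-constʳ (Y B) p) (sides-orthogonal B) ⟨
    Y B · (λ _ → p) xor Y B · X B  ≡⟨ ·-xorʳ (Y B) (λ _ → p) (X B) ⟨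
    Y B · (λ v → p xor X B v)      ≡⟨ sum-cong-≗ (λ v → cong (Y B v ∧_) (xor-moveˡ p (U v) (X≡p+U v))) ⟨
    c                              ≡⟨ c≡true ⟩
    true                           ∎

  X-even : sum (X B) ≡ false
  X-even = begin
    sum (X B)                      ≡⟨ sum-cong-≗ X≡p+U ⟩
    sum (λ v → p xor U v)          ≡⟨ ∑-distrib-+ (λ _ → p) U ⟩
    sum {n} (λ _ → p) xor p        ≡⟨ cong (λ q → sum {n} (λ _ → q) xor q) (∧-conicalʳ (sum (Y B)) p Y∧p) ⟩
    sum {n} (λ _ → true) xor true  ≡⟨ cong (_xor true) odd ⟩
    false                          ∎

first-member-parities : ∀ {N} (B : Biclique (suc N)) Bs → Represents (K (suc N)) (B ∷ Bs) →
  sum {suc N} (λ _ → true) ≡ true → 2 * length (B ∷ Bs) ≤ N →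
  sum (X B) ≡ false × sum (Y B) ≡ true
first-member-parities {N} B Bs rep odd short =
  let U , (i , Uᵢ) , orth = nonzero-solution N (map tail (X B ∷ sides Bs)) fewer
  in  kernel-vector-parities {B = B} {Bs} rep odd {U = false V.∷ U} {zero} {suc i} refl Uᵢ
        (All.map (λ {r} → trans (·-false∷ r U)) (map⁻ orth))
  where
  fewer : length (map tail (X B ∷ sides Bs)) < N
  fewer = subst (_< N) (sym (trans (length-map tail (X B ∷ sides Bs)) (cong suc (length-sides Bs))))
    (subst (_≤ N) (*-suc 2 (length Bs)) short)

oddCover-length-≥ : ∀ k (Bs : List (Biclique (suc (2 * suc k)))) →
  Represents (K (suc (2 * suc k))) Bs → suc (suc k) ≤ length Bs
oddCover-length-≥ k Cs rep = ≮⇒≥ (λ short → too-short Cs rep (s≤s⁻¹ short))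
  where
  too-short : ∀ Bs → Represents (K (suc (2 * suc k))) Bs → length Bs ≤ suc k → ⊥
  too-short []       rep _ with rep zero (suc zero)
  ... | ()
  too-short (B ∷ Bs) rep short = contradiction (trans (sym Y-odd) Y-even) λ ()
    where
    odd : sum {suc (2 * suc k)} (λ _ → true) ≡ true
    odd = sum-true-odd (suc k)
    Y-odd : sum (Y B) ≡ true
    Y-odd = proj₂ (first-member-parities B Bs rep odd (*-monoʳ-≤ 2 short))
    short′ : length (swap B ∷ map swap Bs) ≤ suc k
    short′ = subst (_≤ suc k) (cong suc (sym (length-map swap Bs))) short
    Y-even : sum (Y B) ≡ false
    Y-even = proj₁ (first-member-parities (swap B) (map swap Bs)
      (represents-swap {G = K _} {B ∷ Bs} rep) odd (*-monoʳ-≤ 2 short′))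

-- The construction

data Side : Set where
  inX inY outside : Side

isX isY : Side → Bool
isX inX = true
isX _   = false
isY inY = true
isY _   = false

isX∧isY : ∀ s → isX s ∧ isY s ≡ false
isX∧isY inX     = refl
isX∧isY inY     = refl
isX∧isY outside = refl

infixr 5 _◂_
_◂_ : Side → Biclique n → Biclique (suc n)
s ◂ B = record
  { X        = isX s V.∷ X B
  ; Y        = isY s V.∷ Y B
  ; disjoint = λ { zero → isX∧isY s ; (suc v) → disjoint B v }
  }

neighbours : Side → Biclique n → Vector Bool n
neighbours inX     B = Y B
neighbours inY     B = X B
neighbours outside B = λ _ → false

covers-◂ : ∀ s (B : Biclique n) v → covers (s ◂ B) zero (suc v) ≡ neighbours s B v
covers-◂ inX     B v = trans (cong (Y B v ∨_) (∧-zeroʳ (X B v))) (∨-identityʳ (Y B v))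
covers-◂ inY     B v = ∧-identityʳ (X B v)
covers-◂ outside B v = ∧-zeroʳ (X B v)

sumX : List (Biclique n) → Vector Bool n
sumX Bs v = foldr (λ B acc → X B v xor acc) false Bs

coverParity-◂-suc : ∀ s (Bs : List (Biclique n)) u v →
  coverParity (map (s ◂_) Bs) (suc u) (suc v) ≡ coverParity Bs u v
coverParity-◂-suc s []       u v = refl
coverParity-◂-suc s (B ∷ Bs) u v = cong (covers B u v xor_) (coverParity-◂-suc s Bs u v)

coverParity-outside◂ : ∀ (Bs : List (Biclique n)) v →
  coverParity (map (outside ◂_) Bs) zero (suc v) ≡ false
coverParity-outside◂ []       v = refl
coverParity-outside◂ (B ∷ Bs) v = cong₂ _xor_ (covers-◂ outside B v) (coverParity-outside◂ Bs v)

coverParity-inY◂ : ∀ (Bs : List (Biclique n)) v →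
  coverParity (map (inY ◂_) Bs) zero (suc v) ≡ sumX Bs v
coverParity-inY◂ []       v = refl
coverParity-inY◂ (B ∷ Bs) v = cong₂ _xor_ (covers-◂ inY B v) (coverParity-inY◂ Bs v)

sumX-◂-suc : ∀ s (Bs : List (Biclique n)) v → sumX (map (s ◂_) Bs) (suc v) ≡ sumX Bs v
sumX-◂-suc s []       v = refl
sumX-◂-suc s (B ∷ Bs) v = cong (X B v xor_) (sumX-◂-suc s Bs v)

sumX-◂-zero : ∀ {s} → isX s ≡ false → (Bs : List (Biclique n)) → sumX (map (s ◂_) Bs) zero ≡ false
sumX-◂-zero s∉X []       = refl
sumX-◂-zero s∉X (B ∷ Bs) = cong₂ _xor_ s∉X (sumX-◂-zero s∉X Bs)

record BalancedCover (n k : ℕ) : Set where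
  field
    first         : Biclique n
    others        : List (Biclique n)
    length-others : length others ≡ k
    represents    : Represents (K n) (first ∷ others)
    balanced      : ∀ v → sumX (first ∷ others) v ≡ Y first v

emptyCover : BalancedCover 1 0
emptyCover = record
  { first         = record { X = λ _ → false ; Y = λ _ → false ; disjoint = λ _ → refl }
  ; others        = []
  ; length-others = refl
  ; represents    = λ { zero zero → refl }
  ; balanced      = λ _ → refl
  }

-- The new vertices a and b are zero and suc zero.
module Extension {n k} (C : BalancedCover n k) where
  open BalancedCover C

  complementᵞ : Biclique n
  complementᵞ = record { X = λ _ → false ; Y = λ v → not (Y first v) ; disjoint = λ _ → refl }

  first′ new : Biclique (suc (suc n))
  first′ = inX ◂ inY ◂ first
  new    = inX ◂ inX ◂ complementᵞ

  othersᵇ : List (Biclique (suc n))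
  othersᵇ = map (inY ◂_) others

  others′ : List (Biclique (suc (suc n)))
  others′ = map (outside ◂_) othersᵇ

  cover′ : List (Biclique (suc (suc n)))
  cover′ = first′ ∷ new ∷ others′

  covered-a-b : coverParity cover′ zero (suc zero) ≡ true
  covered-a-b = cong not (coverParity-outside◂ othersᵇ zero)

  covered-a-old : ∀ v → coverParity cover′ zero (suc (suc v)) ≡ true
  covered-a-old v = begin
    covers first′ zero (suc (suc v)) xor covers new zero (suc (suc v))
      xor coverParity others′ zero (suc (suc v))
      ≡⟨ cong₂ _xor_ (covers-◂ inX (inY ◂ first) (suc v))
           (cong₂ _xor_ (covers-◂ inX (inX ◂ complementᵞ) (suc v))
                        (coverParity-outside◂ othersᵇ (suc v))) ⟩
    Y first v xor not (Y first v) xor false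
      ≡⟨ cong (Y first v xor_) (xor-identityʳ _) ⟩
    Y first v xor not (Y first v)
      ≡⟨ xor-inverseʳ (Y first v) ⟩
    true
      ∎

  covered-b-old : ∀ v → coverParity cover′ (suc zero) (suc (suc v)) ≡ true
  covered-b-old v = begin
    covers first′ (suc zero) (suc (suc v)) xor covers new (suc zero) (suc (suc v))
      xor coverParity others′ (suc zero) (suc (suc v))
      ≡⟨ cong₂ _xor_ (covers-◂ inY first v)
           (cong₂ _xor_ (covers-◂ inX complementᵞ v)
                        (trans (coverParity-◂-suc outside othersᵇ zero (suc v))
                               (coverParity-inY◂ others v))) ⟩
    X first v xor not (Y first v) xor sumX others v
      ≡⟨ x∙yz≈y∙xz (X first v) (not (Y first v)) (sumX others v) ⟩
    not (Y first v) xor X first v xor sumX others v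
      ≡⟨ cong (not (Y first v) xor_) (balanced v) ⟩
    not (Y first v) xor Y first v
      ≡⟨ xor-inverseˡ (Y first v) ⟩
    true
      ∎

  covered-old-old : ∀ u v →
    coverParity cover′ (suc (suc u)) (suc (suc v)) ≡ adj (K (suc (suc n))) (suc (suc u)) (suc (suc v))
  covered-old-old u v = begin
    covers first u v xor false xor coverParity others′ (suc (suc u)) (suc (suc v))
      ≡⟨ cong (covers first u v xor_) (trans (coverParity-◂-suc outside othersᵇ (suc u) (suc v))
                                             (coverParity-◂-suc inY others u v)) ⟩
    coverParity (first ∷ others) u v
      ≡⟨ represents u v ⟩
    not ⌊ u ≟ v ⌋
      ≡⟨ cong not (trans (⌊suc≟suc⌋ (suc u) (suc v)) (⌊suc≟suc⌋ u v)) ⟨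
    not ⌊ suc (suc u) ≟ suc (suc v) ⌋
      ∎

  represents′ : Represents (K (suc (suc n))) cover′
  represents′ zero          zero          = coverParity-diag cover′ zero
  represents′ zero          (suc zero)    = covered-a-b
  represents′ zero          (suc (suc v)) = covered-a-old v
  represents′ (suc zero)    zero          =
    trans (coverParity-sym cover′ (suc zero) zero) covered-a-b
  represents′ (suc zero)    (suc zero)    = coverParity-diag cover′ (suc zero)
  represents′ (suc zero)    (suc (suc v)) = covered-b-old v
  represents′ (suc (suc u)) zero          =
    trans (coverParity-sym cover′ (suc (suc u)) zero) (covered-a-old u)
  represents′ (suc (suc u)) (suc zero)    =
    trans (coverParity-sym cover′ (suc (suc u)) (suc zero)) (covered-b-old u)
  represents′ (suc (suc u)) (suc (suc v)) = covered-old-old u v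

  balanced′ : ∀ v → sumX cover′ v ≡ Y first′ v
  balanced′ zero          = cong (λ b → not (not b)) (sumX-◂-zero {s = outside} refl othersᵇ)
  balanced′ (suc zero)    =
    cong not (trans (sumX-◂-suc outside othersᵇ zero) (sumX-◂-zero {s = inY} refl others))
  balanced′ (suc (suc v)) = trans
    (cong (X first v xor_) (trans (sumX-◂-suc outside othersᵇ (suc v)) (sumX-◂-suc inY others v)))
    (balanced v)

  extend : BalancedCover (suc (suc n)) (suc k)
  extend = record
    { first         = first′
    ; others        = new ∷ others′
    ; length-others = cong suc (trans (length-map (outside ◂_) othersᵇ)
                                      (trans (length-map (inY ◂_) others) length-others))
    ; represents    = represents′
    ; balanced      = balanced′
    }

open Extension using (extend)

balancedCover : ∀ m → BalancedCover (suc (2 * m)) m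
balancedCover zero    = emptyCover
balancedCover (suc m) =
  subst (λ l → BalancedCover (suc l) (suc m)) (sym (*-suc 2 m)) (extend (balancedCover m))

theorem15 : ∀ (k : ℕ) → b₂≡ (K (suc (2 * suc k))) (suc (suc k))
theorem15 k =
    (first ∷ others , (λ u v _ → represents u v) , cong suc length-others)
  , (λ Bs cover → oddCover-length-≥ k Bs (isOddCover⇒represents {G = K _} {Bs} cover))
  where open BalancedCover (balancedCover (suc k))
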